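{- Every nonempty partition diagram $\pi$ admits a decomposition $\pi = \theta^{(1)} \bullet \theta^{(2)} \bullet \cdots \bullet \theta^{(m)}$ into nonempty $\bullet$-irreducible partition diagrams $\theta^{(1)},\dots,\theta^{(m)}$, and this decomposition is unique; in particular $m = m(\pi)$ is determined by $\pi$.
   Context: A partition diagram of order $k$ is a set partition of $\{1,\ldots,k,1',\ldots,k'\}$; nonempty means $k\geq1$. For $\pi$ of order $k$, $\rho$ of order $l$, $\pi\otimes\rho$ (order $k+l$) has as blocks the blocks of $\pi$ and the blocks of $\rho$ with $i\mapsto i+k$, $i'\mapsto(i+k)'$. For nonempty $\pi,\rho$ of orders $k,l$, $\pi\bullet\rho$ is the order-$(k+l)$ diagram obtained from $\pi\otimes\rho$ by merging the block containing $k'$ with the block containing $(k+1)'$; $\bullet$ is associative. A nonempty diagram is $\bullet$-irreducible if it cannot be written as $\theta_1\bullet\theta_2$ with $\theta_1,\theta_2$ nonempty diagrams. -}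

module Defs where

open import Data.Nat using (ℕ; zero; suc; _+_)
open import Data.Fin using (Fin; zero; suc; fromℕ; _↑ˡ_; _↑ʳ_; splitAt)
open import Data.Bool using (Bool; true; false; _∧_; _∨_)
open import Data.Sum using (_⊎_; inj₁; inj₂)
open import Data.Product using (Σ; _×_; _,_; proj₁; proj₂)
open import Data.List using (List; []; _∷_)
open import Relation.Binary.PropositionalEquality using (_≡_; subst)
open import Relation.Nullary using (¬_)

-- Points of a partition diagram of order k:
--   inj₁ i  stands for the top vertex     i+1   (i : Fin k)
--   inj₂ i  stands for the bottom vertex (i+1)'
Point : ℕ → Set
Point k = Fin k ⊎ Fin k

-- A (raw) Boolean relation on the points; a set partition of the points is
-- represented by its (decidable) equivalence relation "lie in the same block".
Rel : ℕ → Set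
Rel k = Point k → Point k → Bool

record IsPartition {k : ℕ} (R : Rel k) : Set where
  field
    refl  : ∀ x → R x x ≡ true
    sym   : ∀ x y → R x y ≡ R y x
    trans : ∀ x y z → R x y ≡ true → R y z ≡ true → R x z ≡ true

splitPoint : ∀ k {l} → Point (k + l) → Point k ⊎ Point l
splitPoint k (inj₁ i) with splitAt k i
... | inj₁ a = inj₁ (inj₁ a)
... | inj₂ b = inj₂ (inj₁ b)
splitPoint k (inj₂ i) with splitAt k i
... | inj₁ a = inj₁ (inj₂ a)
... | inj₂ b = inj₂ (inj₂ b)

_⊗_ : ∀ {k l} → Rel k → Rel l → Rel (k + l)
_⊗_ {k} R S x y with splitPoint k x | splitPoint k y
... | inj₁ a | inj₁ b = R a b
... | inj₂ a | inj₂ b = S a b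
... | _      | _      = false

-- Nonempty diagrams: order suc k.
-- π • ρ for π of order suc k, ρ of order suc l: merge the block of k' (bottom
-- vertex number suc k) with the block of (k+1)' (bottom vertex number suc k + 1).
-- For an equivalence relation T, the equivalence relation generated by T and
-- the pair (a , b) is  x ~ y ⇔ T x y ∨ (T x a ∧ T b y) ∨ (T x b ∧ T a y).
_•_ : ∀ {k l} → Rel (suc k) → Rel (suc l) → Rel (suc k + suc l)
_•_ {k} {l} R S x y =
  T x y ∨ (T x a ∧ T b y) ∨ (T x b ∧ T a y)
  where
  T : Rel (suc k + suc l)
  T = R ⊗ S
  a b : Point (suc k + suc l)
  a = inj₂ (fromℕ k ↑ˡ suc l)
  b = inj₂ (suc k ↑ʳ zero)

-- A nonempty diagram together with its order (order = suc (proj₁ d)).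
NDiag : Set
NDiag = Σ ℕ (λ k → Rel (suc k))

_•ₙ_ : NDiag → NDiag → NDiag
(k , R) •ₙ (l , S) = (k + suc l , R • S)

-- equality of diagrams (possibly given at propositionally equal orders)
_≋_ : NDiag → NDiag → Set
(k , R) ≋ (l , S) =
  Σ (k ≡ l) (λ e → ∀ x y → R x y ≡ S (subst (λ n → Point (suc n)) e x)
                                      (subst (λ n → Point (suc n)) e y))

IsPartitionₙ : NDiag → Set
IsPartitionₙ (k , R) = IsPartition R

Irreducible : NDiag → Set
Irreducible d =
  ¬ Σ NDiag (λ θ₁ → Σ NDiag (λ θ₂ →
      IsPartitionₙ θ₁ × IsPartitionₙ θ₂ × ((θ₁ •ₙ θ₂) ≋ d)))

-- θ⁽¹⁾ • θ⁽²⁾ • ⋯ • θ⁽ᵐ⁾ for a nonempty list (head θ⁽¹⁾, tail the rest),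
-- bracketed to the right (• is associative).
•-fold : NDiag → List NDiag → NDiag
•-fold d [] = d
•-fold d (e ∷ es) = d •ₙ •-fold e es

{-# OPTIONS --safe #-}

-- A diagram f of order N splits at p (with p + 1 < N) if it is the •-product of
-- its restriction to the first p + 1 columns and its restriction to the others.
-- For a partition this means that p′ and (p + 1)′ share a block and no other
-- block meets both sides; from this description one sees that if f splits at p
-- and its prefix of order p + 1 splits at p′, then f splits at p′ (this is
-- associativity of •). If f = θ₁ • ⋯ • θₘ, the last columns of θ₁, …, θₘ₋₁ are
-- split points of f, and an irreducible θ₁ admits no split point of f below its
-- last column. Hence the first factor of a decomposition into irreducibles is the
-- prefix of f up to its least split point: this gives uniqueness by induction on
-- the list, and existence by recursing on the remaining suffix.
module Submission where

open import Defs
open import Data.Nat using (ℕ; zero; suc; _+_; _∸_; _<_; _≤_; _<?_; z<s; s<s; s<s⁻¹)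
open import Data.Nat.Properties
open import Data.Nat.Induction using (<-rec)
import Data.Fin as Fin
open import Data.Fin using (toℕ; fromℕ<; fromℕ; _↑ˡ_; _↑ʳ_; splitAt)
open import Data.Fin.Properties
  using (toℕ<n; toℕ-fromℕ<; fromℕ<-toℕ; toℕ-↑ˡ; toℕ-↑ʳ; toℕ-fromℕ; splitAt⁻¹-↑ˡ; splitAt⁻¹-↑ʳ)
open import Data.Bool using (Bool; true; false; _∧_; _∨_)
open import Data.Bool.Properties using (∨-identityʳ; ∧-zeroʳ; ∧-comm; ∧-conicalˡ; ∧-conicalʳ; ⇔→≡)
  renaming (_≟_ to _≟ᵇ_)
open import Data.Sum using (_⊎_; inj₁; inj₂)
open import Data.Product using (Σ; ∃-syntax; _×_; _,_; proj₁; proj₂)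
open import Data.List using (List; []; _∷_)
open import Data.List.Relation.Unary.All using (All; []; _∷_)
open import Data.List.Relation.Binary.Pointwise using (Pointwise; []; _∷_)
open import Data.Empty using (⊥-elim)
open import Function.Bundles using (mk⇔)
open import Relation.Nullary using (¬_; Dec; yes; no)
open import Relation.Nullary.Decidable using (_×-dec_; map′)
open import Relation.Unary using (Decidable)
open import Relation.Binary.PropositionalEquality
  using (_≡_; refl; sym; trans; cong; cong₂; subst; module ≡-Reasoning)

-- A diagram of order n is modelled by a Boolean relation on ℕ ⊎ ℕ of which only
-- the vertices of index < n matter, so that diagrams of different orders live in
-- one type and f ≈[ n ] g is equality of diagrams of order n.
Vertex : Set
Vertex = ℕ ⊎ ℕ

index : Vertex → ℕ
index (inj₁ i) = i
index (inj₂ i) = i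

BRel : Set
BRel = Vertex → Vertex → Bool

infix 4 _≈[_]_

_≈[_]_ : BRel → ℕ → BRel → Set
f ≈[ n ] g = ∀ x y → index x < n → index y < n → f x y ≡ g x y

≈-refl : ∀ {n f} → f ≈[ n ] f
≈-refl _ _ _ _ = refl

≈-sym : ∀ {n f g} → f ≈[ n ] g → g ≈[ n ] f
≈-sym f≈g x y x<n y<n = sym (f≈g x y x<n y<n)

≈-trans : ∀ {n f g h} → f ≈[ n ] g → g ≈[ n ] h → f ≈[ n ] h
≈-trans f≈g g≈h x y x<n y<n = trans (f≈g x y x<n y<n) (g≈h x y x<n y<n)

≈-weaken : ∀ {m n f g} → m ≤ n → f ≈[ n ] g → f ≈[ m ] g
≈-weaken m≤n f≈g x y x<m y<m = f≈g x y (<-≤-trans x<m m≤n) (<-≤-trans y<m m≤n)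

record IsPartitionOn (n : ℕ) (f : BRel) : Set where
  field
    reflexive  : ∀ x → index x < n → f x x ≡ true
    symmetric  : ∀ x y → index x < n → index y < n → f x y ≡ f y x
    transitive : ∀ x y z → index x < n → index y < n → index z < n →
                 f x y ≡ true → f y z ≡ true → f x z ≡ true

shift : ℕ → Vertex → Vertex
shift j (inj₁ i) = inj₁ (j + i)
shift j (inj₂ i) = inj₂ (j + i)

unshift : ℕ → Vertex → Vertex
unshift j (inj₁ i) = inj₁ (i ∸ j)
unshift j (inj₂ i) = inj₂ (i ∸ j)

shift-≥ : ∀ j x → j ≤ index (shift j x)
shift-≥ j (inj₁ i) = m≤m+n j i
shift-≥ j (inj₂ i) = m≤m+n j i

shift-< : ∀ j {m} x → index x < m → index (shift j x) < j + m
shift-< j (inj₁ i) i<m = +-monoʳ-< j i<m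
shift-< j (inj₂ i) i<m = +-monoʳ-< j i<m

unshift-shift : ∀ j x → unshift j (shift j x) ≡ x
unshift-shift j (inj₁ i) = cong inj₁ (m+n∸m≡n j i)
unshift-shift j (inj₂ i) = cong inj₂ (m+n∸m≡n j i)

shift-unshift : ∀ j x → j ≤ index x → shift j (unshift j x) ≡ x
shift-unshift j (inj₁ i) j≤i = cong inj₁ (m+[n∸m]≡n j≤i)
shift-unshift j (inj₂ i) j≤i = cong inj₂ (m+[n∸m]≡n j≤i)

unshift-< : ∀ j m x → index x < j + m → j ≤ index x → index (unshift j x) < m
unshift-< j m (inj₁ i) i<j+m j≤i = subst (i ∸ j <_) (m+n∸m≡n j m) (∸-monoˡ-< i<j+m j≤i)
unshift-< j m (inj₂ i) i<j+m j≤i = subst (i ∸ j <_) (m+n∸m≡n j m) (∸-monoˡ-< i<j+m j≤i)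

suffix : ℕ → BRel → BRel
suffix j f x y = f (shift j x) (shift j y)

suffix-cong : ∀ j m {f g} → f ≈[ j + m ] g → suffix j f ≈[ m ] suffix j g
suffix-cong j m f≈g x y x<m y<m = f≈g (shift j x) (shift j y) (shift-< j x x<m) (shift-< j y y<m)

partition-weaken : ∀ {m n f} → m ≤ n → IsPartitionOn n f → IsPartitionOn m f
partition-weaken m≤n P = record
  { reflexive  = λ x x<m → reflexive x (<-≤-trans x<m m≤n)
  ; symmetric  = λ x y x<m y<m → symmetric x y (<-≤-trans x<m m≤n) (<-≤-trans y<m m≤n)
  ; transitive = λ x y z x<m y<m z<m →
      transitive x y z (<-≤-trans x<m m≤n) (<-≤-trans y<m m≤n) (<-≤-trans z<m m≤n)
  }
  where open IsPartitionOn P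

partition-suffix : ∀ j m {f} → IsPartitionOn (j + m) f → IsPartitionOn m (suffix j f)
partition-suffix j m P = record
  { reflexive  = λ x x<m → reflexive _ (shift-< j x x<m)
  ; symmetric  = λ x y x<m y<m → symmetric _ _ (shift-< j x x<m) (shift-< j y y<m)
  ; transitive = λ x y z x<m y<m z<m →
      transitive _ _ _ (shift-< j x x<m) (shift-< j y y<m) (shift-< j z z<m)
  }
  where open IsPartitionOn P

tensor : ℕ → BRel → BRel → BRel
tensor j g h x y with index x <? j | index y <? j
... | yes _ | yes _ = g x y
... | no _  | no _  = h (unshift j x) (unshift j y)
... | _     | _     = false

tensor-left : ∀ j g h x y → index x < j → index y < j → tensor j g h x y ≡ g x y
tensor-left j g h x y x<j y<j with index x <? j | index y <? j
... | yes _   | yes _   = refl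
... | no x≮j  | _       = ⊥-elim (x≮j x<j)
... | yes _   | no y≮j  = ⊥-elim (y≮j y<j)

tensor-right : ∀ j g h x y → j ≤ index x → j ≤ index y →
               tensor j g h x y ≡ h (unshift j x) (unshift j y)
tensor-right j g h x y j≤x j≤y with index x <? j | index y <? j
... | no _   | no _   = refl
... | yes x<j | _      = ⊥-elim (<⇒≱ x<j j≤x)
... | no _   | yes y<j = ⊥-elim (<⇒≱ y<j j≤y)

tensor-left-right : ∀ j g h x y → index x < j → j ≤ index y → tensor j g h x y ≡ false
tensor-left-right j g h x y x<j j≤y with index x <? j | index y <? j
... | yes _  | no _    = refl
... | no x≮j | _       = ⊥-elim (x≮j x<j)
... | yes _  | yes y<j = ⊥-elim (<⇒≱ y<j j≤y)

tensor-right-left : ∀ j g h x y → j ≤ index x → index y < j → tensor j g h x y ≡ false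
tensor-right-left j g h x y j≤x y<j with index x <? j | index y <? j
... | no _    | yes _  = refl
... | yes x<j | _      = ⊥-elim (<⇒≱ x<j j≤x)
... | no _    | no y≮j = ⊥-elim (y≮j y<j)

tensor-suffix-right : ∀ j g f x y → j ≤ index x → j ≤ index y →
                      tensor j g (suffix j f) x y ≡ f x y
tensor-suffix-right j g f x y j≤x j≤y =
  trans (tensor-right j g (suffix j f) x y j≤x j≤y)
        (cong₂ f (shift-unshift j x j≤x) (shift-unshift j y j≤y))

tensor-cong : ∀ j m {g g′ h h′} → g ≈[ j ] g′ → h ≈[ m ] h′ →
              tensor j g h ≈[ j + m ] tensor j g′ h′
tensor-cong j m g≈g′ h≈h′ x y x<n y<n with index x <? j | index y <? j
... | yes x<j | yes y<j = g≈g′ x y x<j y<j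
... | no x≮j  | no y≮j  =
  h≈h′ _ _ (unshift-< j m x x<n (≮⇒≥ x≮j)) (unshift-< j m y y<n (≮⇒≥ y≮j))
... | yes _   | no _    = refl
... | no _    | yes _   = refl

merge : Vertex → Vertex → BRel → BRel
merge a b T x y = T x y ∨ (T x a ∧ T b y) ∨ (T x b ∧ T a y)

merge-cong : ∀ {n a b T T′} → index a < n → index b < n → T ≈[ n ] T′ →
             merge a b T ≈[ n ] merge a b T′
merge-cong {a = a} {b} a<n b<n T≈T′ x y x<n y<n =
  cong₂ _∨_ (T≈T′ x y x<n y<n)
    (cong₂ _∨_ (cong₂ _∧_ (T≈T′ x a x<n a<n) (T≈T′ b y b<n y<n))
               (cong₂ _∧_ (T≈T′ x b x<n b<n) (T≈T′ a y a<n y<n)))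

glue : ℕ → BRel → BRel → BRel
glue p g h = merge (inj₂ p) (inj₂ (suc p)) (tensor (suc p) g h)

glue-prefix : ∀ p g h → glue p g h ≈[ suc p ] g
glue-prefix p g h x y x<P y<P
  rewrite tensor-left (suc p) g h x y x<P y<P
        | tensor-right-left (suc p) g h (inj₂ (suc p)) y ≤-refl y<P
        | tensor-left-right (suc p) g h x (inj₂ (suc p)) x<P ≤-refl
        | ∧-zeroʳ (tensor (suc p) g h x (inj₂ p))
        = ∨-identityʳ (g x y)

glue-suffix : ∀ p g h x y → suffix (suc p) (glue p g h) x y ≡ h x y
glue-suffix p g h x y
  rewrite tensor-right (suc p) g h (shift (suc p) x) (shift (suc p) y)
            (shift-≥ (suc p) x) (shift-≥ (suc p) y)
        | tensor-right-left (suc p) g h (shift (suc p) x) (inj₂ p) (shift-≥ (suc p) x) ≤-refl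
        | tensor-left-right (suc p) g h (inj₂ p) (shift (suc p) y) ≤-refl (shift-≥ (suc p) y)
        | ∧-zeroʳ (tensor (suc p) g h (shift (suc p) x) (inj₂ (suc p)))
        | unshift-shift (suc p) x | unshift-shift (suc p) y
        = ∨-identityʳ (h x y)

glue-cong : ∀ p m {g g′ h h′} → g ≈[ suc p ] g′ → h ≈[ suc m ] h′ →
            glue p g h ≈[ suc p + suc m ] glue p g′ h′
glue-cong p m g≈g′ h≈h′ =
  merge-cong (<-trans (n<1+n p) b<n) b<n (tensor-cong (suc p) (suc m) g≈g′ h≈h′)
  where
  b<n : suc p < suc p + suc m
  b<n = m<m+n (suc p) z<s

toVertex : ∀ {n} → Point n → Vertex
toVertex (inj₁ i) = inj₁ (toℕ i)
toVertex (inj₂ i) = inj₂ (toℕ i)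

toVertex-< : ∀ {n} (u : Point n) → index (toVertex u) < n
toVertex-< (inj₁ i) = toℕ<n i
toVertex-< (inj₂ i) = toℕ<n i

fromVertex : ∀ {n} x → .(index x < n) → Point n
fromVertex (inj₁ i) i<n = inj₁ (fromℕ< i<n)
fromVertex (inj₂ i) i<n = inj₂ (fromℕ< i<n)

toVertex-fromVertex : ∀ {n} x .(x<n : index x < n) → toVertex (fromVertex x x<n) ≡ x
toVertex-fromVertex (inj₁ i) i<n = cong inj₁ (toℕ-fromℕ< i<n)
toVertex-fromVertex (inj₂ i) i<n = cong inj₂ (toℕ-fromℕ< i<n)

fromVertex-toVertex : ∀ {n} (u : Point n) .(u<n : index (toVertex u) < n) →
                      fromVertex (toVertex u) u<n ≡ u
fromVertex-toVertex (inj₁ i) i<n = cong inj₁ (fromℕ<-toℕ i i<n)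
fromVertex-toVertex (inj₂ i) i<n = cong inj₂ (fromℕ<-toℕ i i<n)

extend : ∀ {n} → Rel n → BRel
extend {n} R x y with index x <? n | index y <? n
... | yes x<n | yes y<n = R (fromVertex x x<n) (fromVertex y y<n)
... | _       | _       = false

extend-inRange : ∀ {n} (R : Rel n) x y (x<n : index x < n) (y<n : index y < n) →
                 extend R x y ≡ R (fromVertex x x<n) (fromVertex y y<n)
extend-inRange {n} R x y x<n y<n with index x <? n | index y <? n
... | yes _  | yes _  = refl
... | no x≮n | _      = ⊥-elim (x≮n x<n)
... | yes _  | no y≮n = ⊥-elim (y≮n y<n)

extend-toVertex : ∀ {n} (R : Rel n) u v → extend R (toVertex u) (toVertex v) ≡ R u v
extend-toVertex R u v =
  trans (extend-inRange R (toVertex u) (toVertex v) (toVertex-< u) (toVertex-< v))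
        (cong₂ R (fromVertex-toVertex u (toVertex-< u)) (fromVertex-toVertex v (toVertex-< v)))

extend-≈ : ∀ {n} (R : Rel n) g → (∀ u v → R u v ≡ g (toVertex u) (toVertex v)) →
           extend R ≈[ n ] g
extend-≈ R g R≡g x y x<n y<n =
  trans (extend-inRange R x y x<n y<n)
    (trans (R≡g _ _) (cong₂ g (toVertex-fromVertex x x<n) (toVertex-fromVertex y y<n)))

restrict : ∀ n → BRel → Rel n
restrict n f u v = f (toVertex u) (toVertex v)

extend-restrict : ∀ n f → extend (restrict n f) ≈[ n ] f
extend-restrict n f = extend-≈ (restrict n f) f (λ _ _ → refl)

partition-extend : ∀ {n} {R : Rel n} → IsPartition R → IsPartitionOn n (extend R)
partition-extend {R = R} P = record
  { reflexive  = λ x x<n → trans (extend-inRange R x x x<n x<n) (R-refl _)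
  ; symmetric  = λ x y x<n y<n →
      trans (extend-inRange R x y x<n y<n) (trans (R-sym _ _) (sym (extend-inRange R y x y<n x<n)))
  ; transitive = λ x y z x<n y<n z<n xy yz →
      trans (extend-inRange R x z x<n z<n)
        (R-trans _ _ _ (trans (sym (extend-inRange R x y x<n y<n)) xy)
                       (trans (sym (extend-inRange R y z y<n z<n)) yz))
  }
  where open IsPartition P renaming (refl to R-refl; sym to R-sym; trans to R-trans)

partition-restrict : ∀ {n f} → IsPartitionOn n f → IsPartition (restrict n f)
partition-restrict P = record
  { refl  = λ u → reflexive _ (toVertex-< u)
  ; sym   = λ u v → symmetric _ _ (toVertex-< u) (toVertex-< v)
  ; trans = λ u v w → transitive _ _ _ (toVertex-< u) (toVertex-< v) (toVertex-< w)
  }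
  where open IsPartitionOn P

splitPoint-left : ∀ k {l} (u : Point (k + l)) w → splitPoint k u ≡ inj₁ w → toVertex u ≡ toVertex w
splitPoint-left k {l} (inj₁ i) w eq with splitAt k i in e
... | inj₁ a with refl ← eq = cong inj₁ (trans (cong toℕ (sym (splitAt⁻¹-↑ˡ e))) (toℕ-↑ˡ a l))
splitPoint-left k {l} (inj₂ i) w eq with splitAt k i in e
... | inj₁ a with refl ← eq = cong inj₂ (trans (cong toℕ (sym (splitAt⁻¹-↑ˡ e))) (toℕ-↑ˡ a l))

splitPoint-right : ∀ k {l} (u : Point (k + l)) w → splitPoint k u ≡ inj₂ w →
                   toVertex u ≡ shift k (toVertex w)
splitPoint-right k (inj₁ i) w eq with splitAt k i in e
... | inj₂ a with refl ← eq = cong inj₁ (trans (cong toℕ (sym (splitAt⁻¹-↑ʳ e))) (toℕ-↑ʳ k a))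
splitPoint-right k (inj₂ i) w eq with splitAt k i in e
... | inj₂ a with refl ← eq = cong inj₂ (trans (cong toℕ (sym (splitAt⁻¹-↑ʳ e))) (toℕ-↑ʳ k a))

⊗-tensor : ∀ k l (R : Rel k) (S : Rel l) u v →
           (R ⊗ S) u v ≡ tensor k (extend R) (extend S) (toVertex u) (toVertex v)
⊗-tensor k l R S u v with splitPoint k u in eu | splitPoint k v in ev
... | inj₁ a | inj₁ b
  rewrite splitPoint-left k u a eu | splitPoint-left k v b ev =
  sym (trans (tensor-left k _ _ _ _ (toVertex-< a) (toVertex-< b)) (extend-toVertex R a b))
... | inj₂ a | inj₂ b
  rewrite splitPoint-right k u a eu | splitPoint-right k v b ev =
  sym (begin
    tensor k (extend R) (extend S) (shift k (toVertex a)) (shift k (toVertex b))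
      ≡⟨ tensor-right k _ _ _ _ (shift-≥ k (toVertex a)) (shift-≥ k (toVertex b)) ⟩
    extend S (unshift k (shift k (toVertex a))) (unshift k (shift k (toVertex b)))
      ≡⟨ cong₂ (extend S) (unshift-shift k (toVertex a)) (unshift-shift k (toVertex b)) ⟩
    extend S (toVertex a) (toVertex b)
      ≡⟨ extend-toVertex S a b ⟩
    S a b ∎)
  where open ≡-Reasoning
... | inj₁ a | inj₂ b
  rewrite splitPoint-left k u a eu | splitPoint-right k v b ev =
  sym (tensor-left-right k _ _ _ _ (toVertex-< a) (shift-≥ k (toVertex b)))
... | inj₂ a | inj₁ b
  rewrite splitPoint-right k u a eu | splitPoint-left k v b ev =
  sym (tensor-right-left k _ _ _ _ (shift-≥ k (toVertex a)) (toVertex-< b))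

•-glue : ∀ k l (R : Rel (suc k)) (S : Rel (suc l)) →
         extend (R • S) ≈[ suc k + suc l ] glue k (extend R) (extend S)
•-glue k l R S =
  ≈-trans (extend-≈ (R • S) (merge (inj₂ k) (inj₂ (suc k)) (extend T)) •-merge)
          (merge-cong (<-trans (n<1+n k) b<n) b<n
            (extend-≈ T (tensor (suc k) (extend R) (extend S)) (⊗-tensor (suc k) (suc l) R S)))
  where
  T = R ⊗ S
  b<n : suc k < suc k + suc l
  b<n = m<m+n (suc k) z<s
  lift : ∀ u v → T u v ≡ extend T (toVertex u) (toVertex v)
  lift u v = sym (extend-toVertex T u v)
  a b : Point (suc k + suc l)
  a = inj₂ (fromℕ k ↑ˡ suc l)
  b = inj₂ (suc k ↑ʳ Fin.zero)
  •-merge : ∀ u v → (R • S) u v ≡ merge (inj₂ k) (inj₂ (suc k)) (extend T) (toVertex u) (toVertex v)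
  •-merge u v = trans
    (cong₂ _∨_ (lift u v) (cong₂ _∨_ (cong₂ _∧_ (lift u a) (lift b v))
                                      (cong₂ _∧_ (lift u b) (lift a v))))
    (cong₂ (λ a′ b′ → merge a′ b′ (extend T) (toVertex u) (toVertex v))
      (cong inj₂ (trans (toℕ-↑ˡ (fromℕ k) (suc l)) (toℕ-fromℕ k)))
      (cong inj₂ (trans (toℕ-↑ʳ (suc k) (Fin.zero {l})) (+-identityʳ (suc k)))))

SplitsAt : ℕ → ℕ → BRel → Set
SplitsAt N p f = suc p < N × f ≈[ N ] glue p f (suffix (suc p) f)

splitsAt-weaken : ∀ {M N p f} → suc p < M → M ≤ N → SplitsAt N p f → SplitsAt M p f
splitsAt-weaken p<M M≤N (_ , split) = p<M , ≈-weaken M≤N split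

splitsAt-cong : ∀ p m {f g} → f ≈[ suc p + suc m ] g →
                SplitsAt (suc p + suc m) p f → SplitsAt (suc p + suc m) p g
splitsAt-cong p m f≈g (p<N , split) =
  p<N , ≈-trans (≈-sym f≈g)
          (≈-trans split (glue-cong p m (≈-weaken (m≤m+n (suc p) (suc m)) f≈g)
                                        (suffix-cong (suc p) (suc m) f≈g)))

module _ (p : ℕ) (g f : BRel) {x y : Vertex} where

  glue-suffix-right : suc p ≤ index x → suc p ≤ index y →
                      glue p g (suffix (suc p) f) x y ≡ f x y
  glue-suffix-right p≤x p≤y
    rewrite tensor-suffix-right (suc p) g f x y p≤x p≤y
          | tensor-right-left (suc p) g (suffix (suc p) f) x (inj₂ p) p≤x ≤-refl
          | tensor-left-right (suc p) g (suffix (suc p) f) (inj₂ p) y ≤-refl p≤y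
          | ∧-zeroʳ (tensor (suc p) g (suffix (suc p) f) x (inj₂ (suc p)))
          = ∨-identityʳ (f x y)

  glue-suffix-left-right : index x < suc p → suc p ≤ index y →
                           glue p g (suffix (suc p) f) x y ≡ g x (inj₂ p) ∧ f (inj₂ (suc p)) y
  glue-suffix-left-right x<P P≤y
    rewrite tensor-left-right (suc p) g (suffix (suc p) f) x y x<P P≤y
          | tensor-left (suc p) g (suffix (suc p) f) x (inj₂ p) x<P ≤-refl
          | tensor-suffix-right (suc p) g f (inj₂ (suc p)) y ≤-refl P≤y
          | tensor-left-right (suc p) g (suffix (suc p) f) x (inj₂ (suc p)) x<P ≤-refl
          = ∨-identityʳ (g x (inj₂ p) ∧ f (inj₂ (suc p)) y)

  glue-suffix-right-left : suc p ≤ index x → index y < suc p →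
                           glue p g (suffix (suc p) f) x y ≡ f x (inj₂ (suc p)) ∧ g (inj₂ p) y
  glue-suffix-right-left P≤x y<P
    rewrite tensor-right-left (suc p) g (suffix (suc p) f) x y P≤x y<P
          | tensor-right-left (suc p) g (suffix (suc p) f) x (inj₂ p) P≤x ≤-refl
          | tensor-suffix-right (suc p) g f x (inj₂ (suc p)) P≤x ≤-refl
          | tensor-left (suc p) g (suffix (suc p) f) (inj₂ p) y ≤-refl y<P
          = refl

SingleCrossing : ℕ → ℕ → BRel → Set
SingleCrossing N p f =
  f (inj₂ p) (inj₂ (suc p)) ≡ true ×
  (∀ x y → index x < suc p → suc p ≤ index y → index y < N →
   f x y ≡ true → f x (inj₂ p) ≡ true)

module _ {N p : ℕ} {f : BRel} (P : IsPartitionOn N f) where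
  open IsPartitionOn P

  splitsAt⇒singleCrossing : SplitsAt N p f → SingleCrossing N p f
  splitsAt⇒singleCrossing (P<N , split) =
    trans (split a b a<N P<N)
      (trans (glue-suffix-left-right p f f ≤-refl ≤-refl)
             (cong₂ _∧_ (reflexive a a<N) (reflexive b P<N))) ,
    λ x y x<P P≤y y<N xy → ∧-conicalˡ _ _
      (trans (sym (glue-suffix-left-right p f f x<P P≤y))
             (trans (sym (split x y (<-trans x<P P<N) y<N)) xy))
    where
    a b : Vertex
    a = inj₂ p
    b = inj₂ (suc p)
    a<N : p < N
    a<N = <-trans (n<1+n p) P<N

  singleCrossing⇒splitsAt : suc p < N → SingleCrossing N p f → SplitsAt N p f
  singleCrossing⇒splitsAt P<N (ab , crossing) = P<N , split
    where
    a b : Vertex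
    a = inj₂ p
    b = inj₂ (suc p)
    a<N : p < N
    a<N = <-trans (n<1+n p) P<N

    left-right : ∀ x y → index x < suc p → suc p ≤ index y → index y < N →
                 f x y ≡ f x a ∧ f b y
    left-right x y x<P P≤y y<N = ⇔→≡ {z = true} (mk⇔ to from)
      where
      x<N = <-trans x<P P<N
      to : f x y ≡ true → f x a ∧ f b y ≡ true
      to xy = cong₂ _∧_ xa (transitive b x y P<N x<N y<N
                (transitive b a x P<N a<N x<N (trans (symmetric b a P<N a<N) ab)
                                             (trans (symmetric a x a<N x<N) xa)) xy)
        where xa = crossing x y x<P P≤y y<N xy
      from : f x a ∧ f b y ≡ true → f x y ≡ true
      from xa∧by = transitive x b y x<N P<N y<N
        (transitive x a b x<N a<N P<N (∧-conicalˡ _ _ xa∧by) ab) (∧-conicalʳ _ _ xa∧by)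

    split : f ≈[ N ] glue p f (suffix (suc p) f)
    split x y x<N y<N with <-≤-connex (index x) (suc p) | <-≤-connex (index y) (suc p)
    ... | inj₁ x<P | inj₁ y<P = sym (glue-prefix p f _ x y x<P y<P)
    ... | inj₂ P≤x | inj₂ P≤y = sym (glue-suffix-right p f f P≤x P≤y)
    ... | inj₁ x<P | inj₂ P≤y =
      trans (left-right x y x<P P≤y y<N) (sym (glue-suffix-left-right p f f x<P P≤y))
    ... | inj₂ P≤x | inj₁ y<P = begin
      f x y                ≡⟨ symmetric x y x<N y<N ⟩
      f y x                ≡⟨ left-right y x y<P P≤x x<N ⟩
      f y a ∧ f b x        ≡⟨ cong₂ _∧_ (symmetric y a y<N a<N) (symmetric b x P<N x<N) ⟩
      f a y ∧ f x b        ≡⟨ ∧-comm (f a y) (f x b) ⟩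
      f x b ∧ f a y        ≡⟨ glue-suffix-right-left p f f P≤x y<P ⟨
      glue p f (suffix (suc p) f) x y ∎
      where open ≡-Reasoning

singleCrossing-trans : ∀ {N p p′ f} → p′ < p →
                       SingleCrossing (suc p) p′ f → SingleCrossing N p f → SingleCrossing N p′ f
singleCrossing-trans {N} {p} {p′} {f} p′<p (ab′ , crossing′) (_ , crossing) = ab′ , crossing″
  where
  crossing″ : ∀ x y → index x < suc p′ → suc p′ ≤ index y → index y < N →
              f x y ≡ true → f x (inj₂ p′) ≡ true
  crossing″ x y x<P′ P′≤y y<N xy with <-≤-connex (index y) (suc p)
  ... | inj₁ y<P = crossing′ x y x<P′ P′≤y y<P xy
  ... | inj₂ P≤y = crossing′ x (inj₂ p) x<P′ p′<p (n<1+n p)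
                     (crossing x y (<-trans x<P′ (s<s p′<p)) P≤y y<N xy)

splitsAt-trans : ∀ {N p p′ f} → IsPartitionOn N f →
                 SplitsAt (suc p) p′ f → SplitsAt N p f → SplitsAt N p′ f
splitsAt-trans P s′@(P′<P , _) s@(P<N , _) =
  singleCrossing⇒splitsAt P (<-trans P′<P P<N)
    (singleCrossing-trans (s<s⁻¹ P′<P)
      (splitsAt⇒singleCrossing (partition-weaken (<⇒≤ P<N) P) s′)
      (splitsAt⇒singleCrossing P s))

order : NDiag → ℕ
order (k , _) = suc k

toBRel : NDiag → BRel
toBRel (_ , R) = extend R

Realises : ℕ → BRel → NDiag → Set
Realises n f d = order d ≡ n × toBRel d ≈[ n ] f

realises-≋ : ∀ {n f} d e → Realises n f d → Realises n f e → d ≋ e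
realises-≋ (k , R) (l , S) (refl , R≈f) (l≡k , S≈f) with suc-injective l≡k
... | refl = refl , λ u v → begin
  R u v                               ≡⟨ extend-toVertex R u v ⟨
  extend R (toVertex u) (toVertex v)  ≡⟨ R≈S (toVertex u) (toVertex v) (toVertex-< u) (toVertex-< v) ⟩
  extend S (toVertex u) (toVertex v)  ≡⟨ extend-toVertex S u v ⟩
  S u v                               ∎
  where
  open ≡-Reasoning
  R≈S = ≈-trans R≈f (≈-sym S≈f)

≋⇒realises : ∀ {k} {R : Rel (suc k)} d → d ≋ (k , R) → Realises (suc k) (extend R) d
≋⇒realises {R = R} (_ , S) (refl , S≡R) =
  refl , extend-≈ S (extend R) (λ u v → trans (S≡R u v) (sym (extend-toVertex R u v)))

realises⇒≋ : ∀ {k} {R : Rel (suc k)} d → Realises (suc k) (extend R) d → d ≋ (k , R)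
realises⇒≋ d r = realises-≋ d _ r (refl , ≈-refl)

restrict-realises : ∀ k f → Realises (suc k) f (k , restrict (suc k) f)
restrict-realises k f = refl , extend-restrict (suc k) f

realises-glue : ∀ {n f} θ X → Realises n f (θ •ₙ X) →
                f ≈[ n ] glue (proj₁ θ) (toBRel θ) (toBRel X)
realises-glue (k , R) (l , S) (refl , e) = ≈-trans (≈-sym e) (•-glue k l R S)

realises-head : ∀ {n f} θ X → Realises n f (θ •ₙ X) → Realises (order θ) f θ
realises-head θ@(k , R) X@(l , S) r@(refl , _) =
  refl , ≈-trans (≈-sym (glue-prefix k (extend R) (extend S)))
                 (≈-weaken (m≤m+n (suc k) (suc l)) (≈-sym (realises-glue θ X r)))

realises-suffix : ∀ {n f} θ X → Realises n f (θ •ₙ X) → toBRel X ≈[ order X ] suffix (order θ) f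
realises-suffix θ@(k , R) X@(l , S) r@(refl , _) x y x<L y<L =
  trans (sym (glue-suffix k (extend R) (extend S) x y))
        (sym (suffix-cong (suc k) (suc l) (realises-glue θ X r) x y x<L y<L))

realises-tail : ∀ {n f} θ X → Realises n f (θ •ₙ X) → Realises (n ∸ order θ) (suffix (order θ) f) X
realises-tail θ@(k , _) X@(l , _) r@(refl , _) =
  sym (m+n∸m≡n (suc k) (suc l)) ,
  ≈-weaken (≤-reflexive (m+n∸m≡n (suc k) (suc l))) (realises-suffix θ X r)

realises-splitsAt : ∀ {n f} θ X → Realises n f (θ •ₙ X) → SplitsAt n (proj₁ θ) f
realises-splitsAt θ@(k , _) X@(l , _) r@(refl , _) =
  m<m+n (suc k) z<s ,
  ≈-trans (realises-glue θ X r)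
    (glue-cong k l (proj₂ (realises-head θ X r)) (realises-suffix θ X r))

realises-•ₙ : ∀ {p m f} θ X → Realises (suc p) f θ → Realises (suc m) (suffix (suc p) f) X →
              SplitsAt (suc p + suc m) p f → Realises (suc p + suc m) f (θ •ₙ X)
realises-•ₙ (p , R) (m , S) (refl , R≈f) (refl , S≈f) (_ , split) =
  refl , ≈-trans (•-glue p m R S) (≈-trans (glue-cong p m R≈f S≈f) (≈-sym split))

Reduction : NDiag → Set
Reduction d = Σ NDiag (λ θ₁ → Σ NDiag (λ θ₂ →
  IsPartitionₙ θ₁ × IsPartitionₙ θ₂ × ((θ₁ •ₙ θ₂) ≋ d)))

splitsAt⇒reduction : ∀ p m (S : Rel (suc (p + suc m))) → IsPartition S →
                     SplitsAt (suc p + suc m) p (extend S) → Reduction (p + suc m , S)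
splitsAt⇒reduction p m S P split =
  (p , restrict (suc p) f) , (m , restrict (suc m) (suffix (suc p) f)) ,
  partition-restrict (partition-weaken (m≤m+n (suc p) (suc m)) (partition-extend P)) ,
  partition-restrict (partition-suffix (suc p) (suc m) (partition-extend P)) ,
  realises⇒≋ (_ •ₙ _) (realises-•ₙ _ _ (restrict-realises p f) (restrict-realises m _) split)
  where
  f = extend S

irreducible⇒¬splitsAt : ∀ {N p f} η → IsPartitionₙ η → Irreducible η →
                        Realises N f η → ¬ SplitsAt N p f
irreducible⇒¬splitsAt {p = p} (q , S) P irreducible (refl , S≈f) split
  with m≤n⇒∃[o]m+o≡n (s<s⁻¹ (proj₁ split))
... | m , p+1+m≡q with trans (+-suc p m) p+1+m≡q
... | refl = irreducible (splitsAt⇒reduction p m S P (splitsAt-cong p m (≈-sym S≈f) split))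

unsplittable⇒irreducible : ∀ k f → (∀ p → ¬ SplitsAt (suc k) p f) →
                           Irreducible (k , restrict (suc k) f)
unsplittable⇒irreducible k f unsplittable (θ₁ , θ₂ , _ , _ , θ₁•θ₂≋) =
  unsplittable (proj₁ θ₁) (realises-splitsAt θ₁ θ₂
    (proj₁ r , ≈-trans (proj₂ r) (extend-restrict (suc k) f)))
  where
  r = ≋⇒realises (θ₁ •ₙ θ₂) θ₁•θ₂≋

AllIrreducible : List NDiag → Set
AllIrreducible = All (λ d → IsPartitionₙ d × Irreducible d)

realises-first : ∀ {n f} θ θs → Realises n f (•-fold θ θs) → order θ ≤ n × Realises (order θ) f θ
realises-first θ []       r@(refl , _) = ≤-refl , r
realises-first θ (d ∷ ds) r            =
  <⇒≤ (proj₁ (realises-splitsAt θ (•-fold d ds) r)) , realises-head θ (•-fold d ds) r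

first-≤-splitsAt : ∀ {n f p} θ θs → IsPartitionₙ θ → Irreducible θ →
                   Realises n f (•-fold θ θs) → SplitsAt n p f → proj₁ θ ≤ p
first-≤-splitsAt θ θs P irreducible r split = ≮⇒≥ λ p<θ →
  irreducible⇒¬splitsAt θ P irreducible (proj₂ first)
    (splitsAt-weaken (s<s p<θ) (proj₁ first) split)
  where
  first = realises-first θ θs r

decomposition-unique : ∀ {n f} θ θs η ηs → AllIrreducible (θ ∷ θs) → AllIrreducible (η ∷ ηs) →
                       Realises n f (•-fold θ θs) → Realises n f (•-fold η ηs) →
                       Pointwise _≋_ (θ ∷ θs) (η ∷ ηs)
decomposition-unique θ [] η [] _ _ rθ rη = realises-≋ θ η rθ rη ∷ []
decomposition-unique θ [] η (e ∷ es) ((Pθ , Iθ) ∷ _) _ rθ rη =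
  ⊥-elim (irreducible⇒¬splitsAt θ Pθ Iθ rθ (realises-splitsAt η (•-fold e es) rη))
decomposition-unique θ (d ∷ ds) η [] _ ((Pη , Iη) ∷ _) rθ rη =
  ⊥-elim (irreducible⇒¬splitsAt η Pη Iη rη (realises-splitsAt θ (•-fold d ds) rθ))
decomposition-unique θ@(k , _) (d ∷ ds) η@(l , _) (e ∷ es) ((Pθ , Iθ) ∷ Aθ) ((Pη , Iη) ∷ Aη) rθ rη
  with ≤-antisym (first-≤-splitsAt θ (d ∷ ds) Pθ Iθ rθ (realises-splitsAt η (•-fold e es) rη))
                 (first-≤-splitsAt η (e ∷ es) Pη Iη rη (realises-splitsAt θ (•-fold d ds) rθ))
... | refl =
  realises-≋ θ η (realises-head θ (•-fold d ds) rθ) (realises-head η (•-fold e es) rη) ∷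
  decomposition-unique d ds e es Aθ Aη
    (realises-tail θ (•-fold d ds) rθ) (realises-tail η (•-fold e es) rη)

AgreeAt : BRel → BRel → ℕ → ℕ → Set
AgreeAt f g i j =
  f (inj₁ i) (inj₁ j) ≡ g (inj₁ i) (inj₁ j) × f (inj₁ i) (inj₂ j) ≡ g (inj₁ i) (inj₂ j) ×
  f (inj₂ i) (inj₁ j) ≡ g (inj₂ i) (inj₁ j) × f (inj₂ i) (inj₂ j) ≡ g (inj₂ i) (inj₂ j)

≈? : ∀ n f g → Dec (f ≈[ n ] g)
≈? n f g =
  map′ from to (allUpTo? (λ i → allUpTo? (λ j → agreeAt? i j) n) n)
  where
  agreeAt? : ∀ i j → Dec (AgreeAt f g i j)
  agreeAt? i j = (_ ≟ᵇ _) ×-dec (_ ≟ᵇ _) ×-dec (_ ≟ᵇ _) ×-dec (_ ≟ᵇ _)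
  from : (∀ {i} → i < n → ∀ {j} → j < n → AgreeAt f g i j) → f ≈[ n ] g
  from agree (inj₁ i) (inj₁ j) i<n j<n = proj₁ (agree i<n j<n)
  from agree (inj₁ i) (inj₂ j) i<n j<n = proj₁ (proj₂ (agree i<n j<n))
  from agree (inj₂ i) (inj₁ j) i<n j<n = proj₁ (proj₂ (proj₂ (agree i<n j<n)))
  from agree (inj₂ i) (inj₂ j) i<n j<n = proj₂ (proj₂ (proj₂ (agree i<n j<n)))
  to : f ≈[ n ] g → ∀ {i} → i < n → ∀ {j} → j < n → AgreeAt f g i j
  to f≈g i<n j<n = f≈g _ _ i<n j<n , f≈g _ _ i<n j<n , f≈g _ _ i<n j<n , f≈g _ _ i<n j<n

splitsAt? : ∀ N p f → Dec (SplitsAt N p f)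
splitsAt? N p f = (suc p <? N) ×-dec ≈? N f _

module _ {P : ℕ → Set} (P? : Decidable P) where

  least-below : ∀ v → (∀ {n} → n < v → ¬ P n) ⊎ ∃[ n ] P n × (∀ {m} → m < n → ¬ P m)
  least-below zero = inj₁ λ ()
  least-below (suc v) with least-below v
  ... | inj₂ least = inj₂ least
  ... | inj₁ none with P? v
  ...   | yes Pv = inj₂ (v , Pv , none)
  ...   | no ¬Pv = inj₁ none′
    where
    none′ : ∀ {n} → n < suc v → ¬ P n
    none′ n<1+v with m<1+n⇒m<n∨m≡n n<1+v
    ... | inj₁ n<v  = none n<v
    ... | inj₂ refl = ¬Pv

Decomposition : ℕ → BRel → Set
Decomposition n f = Σ NDiag λ θ → Σ (List NDiag) λ θs →
  AllIrreducible (θ ∷ θs) × Realises n f (•-fold θ θs)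

decomposition : ∀ k f → IsPartitionOn (suc k) f → Decomposition (suc k) f
decomposition = <-rec _ decompose
  where
  decompose : ∀ k → (∀ {m} → m < k → ∀ f → IsPartitionOn (suc m) f → Decomposition (suc m) f) →
              ∀ f → IsPartitionOn (suc k) f → Decomposition (suc k) f
  decompose k rec f P with least-below (λ p → splitsAt? (suc k) p f) (suc k)
  ... | inj₁ none =
    (k , restrict (suc k) f) , [] ,
    (partition-restrict P ,
     unsplittable⇒irreducible k f (λ p split → none (<-trans (n<1+n p) (proj₁ split)) split)) ∷ [] ,
    restrict-realises k f
  ... | inj₂ (p , split , below) with m≤n⇒∃[o]m+o≡n (s<s⁻¹ (proj₁ split))
  ... | m , p+1+m≡k with trans (+-suc p m) p+1+m≡k
  ... | refl with rec (m≤n+m (suc m) p) (suffix (suc p) f) (partition-suffix (suc p) (suc m) P)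
  ... | θ , θs , irreducibles , r =
    (p , restrict (suc p) f) , θ ∷ θs ,
    (partition-restrict (partition-weaken (<⇒≤ (proj₁ split)) P) ,
     unsplittable⇒irreducible p f
       (λ p′ split′ → below (s<s⁻¹ (proj₁ split′)) (splitsAt-trans P split′ split)))
    ∷ irreducibles ,
    realises-•ₙ _ _ (restrict-realises p f) r split

theorem3p9 : (k : ℕ) (π : Rel (suc k)) → IsPartition π →
    Σ NDiag (λ θ → Σ (List NDiag) (λ θs →
        All (λ d → IsPartitionₙ d × Irreducible d) (θ ∷ θs)
        × (•-fold θ θs ≋ (k , π))))
    × ((θ : NDiag) (θs : List NDiag) (η : NDiag) (ηs : List NDiag) →
        All (λ d → IsPartitionₙ d × Irreducible d) (θ ∷ θs) →
        (•-fold θ θs ≋ (k , π)) →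
        All (λ d → IsPartitionₙ d × Irreducible d) (η ∷ ηs) →
        (•-fold η ηs ≋ (k , π)) →
        Pointwise _≋_ (θ ∷ θs) (η ∷ ηs))
theorem3p9 k π P = existence , uniqueness
  where
  existence = let θ , θs , irreducibles , r = decomposition k (extend π) (partition-extend P)
              in θ , θs , irreducibles , realises⇒≋ (•-fold θ θs) r
  uniqueness = λ θ θs η ηs Aθ θ≋π Aη η≋π →
    decomposition-unique θ θs η ηs Aθ Aη (≋⇒realises {R = π} _ θ≋π) (≋⇒realises {R = π} _ η≋π)
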